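{- Let $r\geqslant 1$, let $\mathrm{BF}(r)$ and $S^{(r)}=S_0\cup\cdots\cup S_r$ be as in the context, and let $X_0,X_1,\dots,X_r$ be defined by $X_0=S^{(r)}$ and, for $k=1,\dots,r$, \[X_k=X_{k-1}\cup\left\{(x,r-k): \{(x,r-k)\}=N(v)\setminus X_{k-1}\text{ for some }v=(y,r-k+1)\in X_{k-1}\right\}.\] For $k\in\{0,1,\dots,r\}$ write $X_k(i)=X_k\cap V_i$. Then for every $k\in\{0,1,\dots,r\}$: \[X_k(i)=S_i\quad\text{for } i\in\{0,1,\dots,r-k-1\}\cup\{r\},\] \[X_k(i)=\left\{(x,i): 2^{i}\ell\leqslant x\leqslant 2^{i}\ell+J_{i+1}-1\text{ for some integer }\ell\right\}\quad\text{for } i\in\{r-k,\dots,r-1\}.\]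
   Context: $(J_n)$ is the Jacobsthal sequence: $J_0=0$, $J_1=1$, $J_n=J_{n-1}+2J_{n-2}$. The butterfly network $\mathrm{BF}(r)$ has vertex set $\bigcup_{i=0}^r V_i$ with $V_i=\{(x,i): x\in\{0,\dots,2^r-1\}\}$, each $x$ identified with the binary vector $(x_1,\dots,x_r)$ with $x=\sum_j x_j2^{j-1}$; edges join $(x,i-1)$ and $(y,i)$ for $1\leqslant i\leqslant r$ and $y\in\{x,x+e_i\}$ (addition modulo 2, $e_i$ the $i$-th unit vector). $N(v)$ denotes the set of neighbors of $v$. The set $S^{(r)}$ is given by $S_i=\{(x,i): 2^{i+1}\ell\leqslant x\leqslant 2^{i+1}\ell+J_{i+1}-1 \text{ for some integer }\ell\}$ for $i=0,\dots,r-1$ and $S_r=\{(x,r): 0\leqslant x\leqslant J_{r+1}-1\}$. -}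

module Defs where

open import Data.Nat using (ℕ; zero; suc; _+_; _*_; _∸_; _^_; _≤_; _<_)
open import Data.Nat.DivMod using (_/_; _%_)
open import Data.Nat.Properties using (_≟_)
open import Data.Product using (_×_; _,_; ∃-syntax; proj₁; proj₂)
open import Data.Sum using (_⊎_)
open import Relation.Nullary using (¬_; yes; no)
open import Relation.Binary.PropositionalEquality using (_≡_)

J : ℕ → ℕ
J zero = 0
J (suc zero) = 1
J (suc (suc n)) = J (suc n) + 2 * J n

-- A (potential) vertex (x , i) : x is the binary word, i the level.
Vertex : Set
Vertex = ℕ × ℕ

VSet : Set₁
VSet = Vertex → Set

IsVertex : ℕ → Vertex → Set
IsVertex r (x , i) = (x < 2 ^ r) × (i ≤ r)

-- bit j of x (coefficient of 2^j), i.e. x_{j+1} in the paper's indexing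
bit : ℕ → ℕ → ℕ
bit zero x = x % 2
bit (suc j) x = bit j (x / 2)

-- x + e_i (mod 2), for i ≥ 1: flips the coefficient of 2^(i-1)
flipE : ℕ → ℕ → ℕ
flipE i x with bit (i ∸ 1) x ≟ 1
... | yes _ = x ∸ 2 ^ (i ∸ 1)
... | no  _ = x + 2 ^ (i ∸ 1)

EdgeUp : ℕ → Vertex → Vertex → Set
EdgeUp r (x , a) (y , b) =
  IsVertex r (x , a) × IsVertex r (y , b) × (b ≡ suc a) ×
  ((y ≡ x) ⊎ (y ≡ flipE b x))

-- Adjacency in BF(r) (undirected); Adj r v u  means  u ∈ N(v)
Adj : ℕ → Vertex → Vertex → Set
Adj r u v = EdgeUp r u v ⊎ EdgeUp r v u

S : ℕ → VSet
S r (x , i) =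
  IsVertex r (x , i) ×
  ((i < r × ∃[ ℓ ] (2 ^ (suc i) * ℓ ≤ x × x ≤ 2 ^ (suc i) * ℓ + J (suc i) ∸ 1))
   ⊎ (i ≡ r × x ≤ J (suc r) ∸ 1))

X : ℕ → ℕ → VSet
X r zero u = S r u
X r (suc k) (x , i) =
  X r k (x , i) ⊎
  ((i ≡ r ∸ suc k) ×
   ∃[ v ] (X r k v × (proj₂ v ≡ r ∸ k) ×
           -- {(x , i)} = N(v) \ X_{k-1}
           (Adj r v (x , i) × ¬ X r k (x , i)) ×
           (∀ u → Adj r v u → ¬ X r k u → u ≡ (x , i))))

T : ℕ → VSet
T r (x , i) =
  IsVertex r (x , i) ×
  ∃[ ℓ ] (2 ^ i * ℓ ≤ x × x ≤ 2 ^ i * ℓ + J (suc i) ∸ 1)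

module Submission where

-- All three families of vertex sets are governed by low-order binary digits:
-- for c with 1 ≤ c ≤ 2^a, the union of the intervals [2^a ℓ, 2^a ℓ + c - 1]
-- is exactly {x : x mod 2^a < c}.  So S_i = {x mod 2^(i+1) < J(i+1)}, the
-- target set T_i = {x mod 2^i < J(i+1)}, and S_r = {x < J(r+1)}.
--
-- The theorem follows by induction on k: passing
-- from X_k to X_(k+1) only adds vertices on level L = r - k - 1, and on that
-- level a vertex (x, L) is forced exactly when x mod 2^L < J(L+1) but bit L of
-- x is 1; its forcing vertex is (x + e_(L+1), L+1), all of whose other
-- neighbours already lie in X_k by the identity J(L+3) = J(L+1) + 2^(L+1).

open import Defs
open import Data.Nat using (ℕ; _+_; _∸_; _≤_; _<_)
open import Data.Product using (_×_; _,_)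
open import Data.Sum using (_⊎_)
open import Function.Bundles using (_⇔_)
open import Relation.Binary.PropositionalEquality using (_≡_)
open import Data.Empty using (⊥; ⊥-elim)
open import Data.Nat using (zero; suc; _*_; _^_; NonZero; z≤n; s≤s; s≤s⁻¹; _<?_)
open import Data.Nat.DivMod
open import Data.Nat.Properties
open import Data.Nat.Solver using (module +-*-Solver)
open import Data.Product using (∃-syntax; proj₁; proj₂)
open import Data.Sum using (inj₁; inj₂)
open import Function.Bundles using (mk⇔; Equivalence)
import Function.Properties.Equivalence as ⇔
open import Relation.Binary.PropositionalEquality
  using (refl; sym; trans; cong; cong₂; subst; module ≡-Reasoning)
open import Relation.Nullary using (¬_; yes; no)

open +-*-Solver using (solve; _:+_; _:*_; _:=_; con)
open Equivalence using (to; from)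

2^-nonZero : ∀ n → NonZero (2 ^ n)
2^-nonZero n = m^n≢0 2 n

low : ℕ → ℕ → ℕ
low a x = _%_ x (2 ^ a) {{2^-nonZero a}}

high : ℕ → ℕ → ℕ
high a x = _/_ x (2 ^ a) {{2^-nonZero a}}

low-< : ∀ a x → low a x < 2 ^ a
low-< a x = m%n<n x (2 ^ a) {{2^-nonZero a}}

bit≤1 : ∀ a x → bit a x ≤ 1
bit≤1 zero    x = s≤s⁻¹ (m%n<n x 2)
bit≤1 (suc a) x = bit≤1 a (x / 2)

2^suc : ∀ n → 2 ^ suc n ≡ 2 ^ n * 2
2^suc n = *-comm 2 (2 ^ n)

%-double : ∀ n x .{{_ : NonZero n}} .{{_ : NonZero (n * 2)}} →
           x % (n * 2) ≡ (x / 2) % n * 2 + x % 2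
%-double n x = begin
    x % (n * 2)
  ≡⟨ %-congˡ (trans (m≡m%n+[m/n]*n x 2) (+-comm (x % 2) _)) ⟩
    (x / 2 * 2 + x % 2) % (n * 2)
  ≡⟨ [m*n+o]%[p*n]≡[m*n]%[p*n]+o (x / 2) n (m%n<n x 2) ⟩
    (x / 2 * 2) % (n * 2) + x % 2
  ≡⟨ cong (_+ x % 2) (sym (m%n*o≡m*o%[n*o] (x / 2) n 2)) ⟩
    (x / 2) % n * 2 + x % 2 ∎
  where open ≡-Reasoning

low-suc : ∀ a x → low (suc a) x ≡ low a x + bit a x * 2 ^ a
low-suc zero x = begin
    x % 2                  ≡⟨ sym (*-identityʳ (x % 2)) ⟩
    x % 2 * 1              ≡⟨ cong (_+ x % 2 * 1) (sym (n%1≡0 x)) ⟩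
    x % 1 + x % 2 * 1      ∎
  where open ≡-Reasoning
low-suc (suc a) x = begin
    low (suc (suc a)) x
  ≡⟨ %-congʳ (2^suc (suc a)) ⟩
    x % (2 ^ suc a * 2)
  ≡⟨ %-double (2 ^ suc a) x ⟩
    low (suc a) h * 2 + x % 2
  ≡⟨ cong (λ t → t * 2 + x % 2) (low-suc a h) ⟩
    (low a h + bit a h * 2 ^ a) * 2 + x % 2
  ≡⟨ regroup (low a h) (bit a h) (2 ^ a) (x % 2) ⟩
    (low a h * 2 + x % 2) + bit a h * (2 ^ a * 2)
  ≡⟨ cong₂ (λ s t → s + bit a h * t) (sym (%-double (2 ^ a) x)) (sym (2^suc a)) ⟩
    x % (2 ^ a * 2) + bit a h * 2 ^ suc a
  ≡⟨ cong (_+ bit a h * 2 ^ suc a) (%-congʳ (sym (2^suc a))) ⟩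
    low (suc a) x + bit (suc a) x * 2 ^ suc a ∎
  where
  open ≡-Reasoning
  instance _ = 2^-nonZero a ; _ = 2^-nonZero (suc a) ; _ = 2^-nonZero (suc (suc a))
           _ = m*n≢0 (2 ^ a) 2 ; _ = m*n≢0 (2 ^ suc a) 2
  h = x / 2
  regroup : ∀ A B C D → (A + B * C) * 2 + D ≡ (A * 2 + D) + B * (C * 2)
  regroup = solve 4 (λ A B C D → (A :+ B :* C) :* con 2 :+ D
                                   := (A :* con 2 :+ D) :+ B :* (C :* con 2)) refl

low-mono-suc : ∀ a x → low a x ≤ low (suc a) x
low-mono-suc a x = subst (low a x ≤_) (sym (low-suc a x)) (m≤m+n _ _)

binary-split : ∀ a x → x ≡ low a x + bit a x * 2 ^ a + high (suc a) x * 2 ^ suc a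
binary-split a x = trans (m≡m%n+[m/n]*n x (2 ^ suc a))
                         (cong (_+ high (suc a) x * 2 ^ suc a) (low-suc a x))
  where instance _ = 2^-nonZero (suc a)

low-plus-bit-< : ∀ a R c → R < 2 ^ a → c ≤ 1 → R + c * 2 ^ a < 2 ^ suc a
low-plus-bit-< a R c R< c≤1 = begin-strict
    R + c * 2 ^ a     <⟨ +-monoˡ-< (c * 2 ^ a) R< ⟩
    2 ^ a + c * 2 ^ a ≤⟨ +-monoʳ-≤ (2 ^ a) (*-monoˡ-≤ (2 ^ a) c≤1) ⟩
    2 ^ a + 1 * 2 ^ a ≡⟨ cong (2 ^ a +_) (trans (*-identityˡ (2 ^ a)) (sym (+-identityʳ (2 ^ a)))) ⟩
    2 ^ suc a         ∎
  where open ≤-Reasoning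

split-unique : ∀ a R c Q → R < 2 ^ a → c ≤ 1 →
  let y = R + c * 2 ^ a + Q * 2 ^ suc a in
  (low a y ≡ R) × (bit a y ≡ c) × (high (suc a) y ≡ Q)
split-unique a R c Q R< c≤1 = low-y , bit-y , high-y
  where
  instance _ = 2^-nonZero a ; _ = 2^-nonZero (suc a)
  y = R + c * 2 ^ a + Q * 2 ^ suc a
  y-over-2^a : y ≡ R + (c + Q * 2) * 2 ^ a
  y-over-2^a = regroup R c Q (2 ^ a)
    where
    regroup : ∀ R c Q P → R + c * P + Q * (2 * P) ≡ R + (c + Q * 2) * P
    regroup = solve 4 (λ R c Q P → R :+ c :* P :+ Q :* (con 2 :* P)
                                     := R :+ (c :+ Q :* con 2) :* P) refl
  low-y : low a y ≡ R
  low-y = trans (%-congˡ y-over-2^a)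
                (trans ([m+kn]%n≡m%n R (c + Q * 2) (2 ^ a)) (m<n⇒m%n≡m R<))
  low-suc-y : low (suc a) y ≡ R + c * 2 ^ a
  low-suc-y = trans ([m+kn]%n≡m%n (R + c * 2 ^ a) Q (2 ^ suc a))
                    (m<n⇒m%n≡m (low-plus-bit-< a R c R< c≤1))
  bit-y : bit a y ≡ c
  bit-y = sym (*-cancelʳ-≡ c (bit a y) (2 ^ a) (+-cancelˡ-≡ R _ _
            (trans (sym low-suc-y) (trans (low-suc a y) (cong (_+ bit a y * 2 ^ a) low-y)))))
  high-y : high (suc a) y ≡ Q
  high-y = *-cancelʳ-≡ (high (suc a) y) Q (2 ^ suc a) (+-cancelˡ-≡ (R + c * 2 ^ a) _ _
             (trans (cong (_+ high (suc a) y * 2 ^ suc a) (sym low-suc-y))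
                    (sym (m≡m%n+[m/n]*n y (2 ^ suc a)))))

bit≢1⇒bit≡0 : ∀ a x → ¬ bit a x ≡ 1 → bit a x ≡ 0
bit≢1⇒bit≡0 a x ne = n<1⇒n≡0 (≤∧≢⇒< (bit≤1 a x) ne)

-- Adding 2^a to a number whose bit a is 0 sets that bit.
set-bit : ∀ R Q P → R + 0 * P + Q * (2 * P) + P ≡ R + 1 * P + Q * (2 * P)
set-bit = solve 3 (λ R Q P → R :+ con 0 :* P :+ Q :* (con 2 :* P) :+ P
                             := R :+ con 1 :* P :+ Q :* (con 2 :* P)) refl

flip-split : ∀ a x → flipE (suc a) x ≡ low a x + (1 ∸ bit a x) * 2 ^ a + high (suc a) x * 2 ^ suc a
flip-split a x with bit a x ≟ 1
... | yes b≡1 = begin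
    x ∸ 2 ^ a
  ≡⟨ cong (_∸ 2 ^ a) (binary-split a x) ⟩
    R + bit a x * 2 ^ a + Q * 2 ^ suc a ∸ 2 ^ a
  ≡⟨ cong (λ t → R + t * 2 ^ a + Q * 2 ^ suc a ∸ 2 ^ a) b≡1 ⟩
    R + 1 * 2 ^ a + Q * 2 ^ suc a ∸ 2 ^ a
  ≡⟨ cong (_∸ 2 ^ a) (sym (set-bit R Q (2 ^ a))) ⟩
    R + 0 * 2 ^ a + Q * 2 ^ suc a + 2 ^ a ∸ 2 ^ a
  ≡⟨ m+n∸n≡m (R + 0 * 2 ^ a + Q * 2 ^ suc a) (2 ^ a) ⟩
    R + 0 * 2 ^ a + Q * 2 ^ suc a
  ≡⟨ cong (λ t → R + (1 ∸ t) * 2 ^ a + Q * 2 ^ suc a) (sym b≡1) ⟩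
    R + (1 ∸ bit a x) * 2 ^ a + Q * 2 ^ suc a ∎
  where
  open ≡-Reasoning
  R = low a x
  Q = high (suc a) x
... | no b≢1 = begin
    x + 2 ^ a
  ≡⟨ cong (_+ 2 ^ a) (binary-split a x) ⟩
    R + bit a x * 2 ^ a + Q * 2 ^ suc a + 2 ^ a
  ≡⟨ cong (λ t → R + t * 2 ^ a + Q * 2 ^ suc a + 2 ^ a) b≡0 ⟩
    R + 0 * 2 ^ a + Q * 2 ^ suc a + 2 ^ a
  ≡⟨ set-bit R Q (2 ^ a) ⟩
    R + 1 * 2 ^ a + Q * 2 ^ suc a
  ≡⟨ cong (λ t → R + (1 ∸ t) * 2 ^ a + Q * 2 ^ suc a) (sym b≡0) ⟩
    R + (1 ∸ bit a x) * 2 ^ a + Q * 2 ^ suc a ∎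
  where
  open ≡-Reasoning
  R = low a x
  Q = high (suc a) x
  b≡0 : bit a x ≡ 0
  b≡0 = bit≢1⇒bit≡0 a x b≢1

module _ (a x : ℕ) where
  private
    parts = split-unique a (low a x) (1 ∸ bit a x) (high (suc a) x) (low-< a x) (m∸n≤m 1 (bit a x))

  flip-low : low a (flipE (suc a) x) ≡ low a x
  flip-low = trans (cong (low a) (flip-split a x)) (proj₁ parts)

  flip-bit : bit a (flipE (suc a) x) ≡ 1 ∸ bit a x
  flip-bit = trans (cong (bit a) (flip-split a x)) (proj₁ (proj₂ parts))

  flip-high : high (suc a) (flipE (suc a) x) ≡ high (suc a) x
  flip-high = trans (cong (high (suc a)) (flip-split a x)) (proj₂ (proj₂ parts))

flip-involutive : ∀ a x → flipE (suc a) (flipE (suc a) x) ≡ x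
flip-involutive a x = begin
    flipE (suc a) y
  ≡⟨ flip-split a y ⟩
    low a y + (1 ∸ bit a y) * 2 ^ a + high (suc a) y * 2 ^ suc a
  ≡⟨ cong₂ _+_ (cong₂ (λ s t → s + (1 ∸ t) * 2 ^ a) (flip-low a x) (flip-bit a x))
               (cong (_* 2 ^ suc a) (flip-high a x)) ⟩
    low a x + (1 ∸ (1 ∸ bit a x)) * 2 ^ a + high (suc a) x * 2 ^ suc a
  ≡⟨ cong (λ t → low a x + t * 2 ^ a + high (suc a) x * 2 ^ suc a) (m∸[m∸n]≡n (bit≤1 a x)) ⟩
    low a x + bit a x * 2 ^ a + high (suc a) x * 2 ^ suc a
  ≡⟨ sym (binary-split a x) ⟩
    x ∎
  where
  open ≡-Reasoning
  y = flipE (suc a) x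

flip-moves : ∀ a x → ¬ flipE (suc a) x ≡ x
flip-moves a x eq = no-fixed-point (bit≤1 a x) (trans (sym (cong (bit a) eq)) (flip-bit a x))
  where
  no-fixed-point : ∀ {b} → b ≤ 1 → b ≡ 1 ∸ b → ⊥
  no-fixed-point {zero}  _ ()
  no-fixed-point {suc zero} _ ()

-- Both up-neighbours u ∈ {y, y + e_(a+2)} agree with y in the a+1 low bits, so
-- u mod 2^(a+2) exceeds y mod 2^(a+1) by at most 2^(a+1).
up-neighbour-low : ∀ a y u → (u ≡ y) ⊎ (u ≡ flipE (suc (suc a)) y) →
                   low (suc (suc a)) u ≤ low (suc a) y + 2 ^ suc a
up-neighbour-low a y u u≈y = begin
    low (suc (suc a)) u                        ≡⟨ low-suc (suc a) u ⟩
    low (suc a) u + bit (suc a) u * 2 ^ suc a  ≤⟨ +-monoʳ-≤ (low (suc a) u) (*-monoˡ-≤ (2 ^ suc a) (bit≤1 (suc a) u)) ⟩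
    low (suc a) u + 1 * 2 ^ suc a              ≡⟨ cong₂ _+_ (same-low u≈y) (*-identityˡ _) ⟩
    low (suc a) y + 2 ^ suc a                  ∎
  where
  open ≤-Reasoning
  same-low : (u ≡ y) ⊎ (u ≡ flipE (suc (suc a)) y) → low (suc a) u ≡ low (suc a) y
  same-low (inj₁ e) = cong (low (suc a)) e
  same-low (inj₂ e) = trans (cong (low (suc a)) e) (flip-low (suc a) y)

flip-< : ∀ a x r → suc a ≤ r → x < 2 ^ r → flipE (suc a) x < 2 ^ r
flip-< a x r a<r x< = begin-strict
    flipE (suc a) x
  ≡⟨ flip-split a x ⟩
    low a x + (1 ∸ bit a x) * 2 ^ a + Q * P
  <⟨ +-monoˡ-< (Q * P) (low-plus-bit-< a (low a x) (1 ∸ bit a x) (low-< a x) (m∸n≤m 1 (bit a x))) ⟩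
    P + Q * P
  ≤⟨ *-monoˡ-≤ P Q<2^m ⟩
    2 ^ m * P
  ≡⟨ 2^r-split ⟩
    2 ^ r ∎
  where
  open ≤-Reasoning
  P = 2 ^ suc a
  Q = high (suc a) x
  m = r ∸ suc a
  2^r-split : 2 ^ m * P ≡ 2 ^ r
  2^r-split = trans (*-comm (2 ^ m) P)
                    (trans (sym (^-distribˡ-+-* 2 (suc a) m)) (cong (2 ^_) (m+[n∸m]≡n a<r)))
  Q<2^m : Q < 2 ^ m
  Q<2^m = m<n*o⇒m/o<n {{2^-nonZero (suc a)}} (subst (x <_) (sym 2^r-split) x<)

J-sum : ∀ n → J n + J (suc n) ≡ 2 ^ n
J-sum zero    = refl
J-sum (suc n) = trans (regroup (J n) (J (suc n))) (cong (2 *_) (J-sum n))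
  where
  regroup : ∀ A B → B + (B + 2 * A) ≡ 2 * (A + B)
  regroup = solve 2 (λ A B → B :+ (B :+ con 2 :* A) := con 2 :* (A :+ B)) refl

J-pos : ∀ n → 1 ≤ J (suc n)
J-pos zero    = s≤s z≤n
J-pos (suc n) = ≤-trans (J-pos n) (m≤m+n (J (suc n)) _)

J≤2^ : ∀ n → J (suc n) ≤ 2 ^ n
J≤2^ n = subst (J (suc n) ≤_) (J-sum n) (m≤n+m (J (suc n)) (J n))

J≤2^suc : ∀ n → J (suc n) ≤ 2 ^ suc n
J≤2^suc n = ≤-trans (J≤2^ n) (^-monoʳ-≤ 2 (n≤1+n n))

J-two-steps : ∀ n → J (suc (suc (suc n))) ≡ J (suc n) + 2 ^ suc n
J-two-steps n = trans (regroup (J (suc n)) (J (suc (suc n)))) (cong (J (suc n) +_) (J-sum (suc n)))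
  where
  regroup : ∀ A B → B + 2 * A ≡ A + (A + B)
  regroup = solve 2 (λ A B → B :+ con 2 :* A := A :+ (A :+ B)) refl

≤pred⇒< : ∀ {x c} → 1 ≤ c → x ≤ c ∸ 1 → x < c
≤pred⇒< {c = suc c} _ h = s≤s h

interval⇔low : ∀ a c x → 1 ≤ c → c ≤ 2 ^ a →
  (∃[ ℓ ] (2 ^ a * ℓ ≤ x × x ≤ 2 ^ a * ℓ + c ∸ 1)) ⇔ (low a x < c)
interval⇔low a c x 1≤c c≤2^a = mk⇔ into outof
  where
  instance _ = 2^-nonZero a
  P = 2 ^ a
  into : (∃[ ℓ ] (P * ℓ ≤ x × x ≤ P * ℓ + c ∸ 1)) → low a x < c
  into (ℓ , lo , hi) = subst (_< c) (sym low≡d) d<c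
    where
    d = x ∸ P * ℓ
    x≡d+ℓP : x ≡ d + ℓ * P
    x≡d+ℓP = trans (sym (m∸n+n≡m lo)) (cong (d +_) (*-comm P ℓ))
    d<c : d < c
    d<c = ≤pred⇒< 1≤c (subst (d ≤_)
            (trans (cong (_∸ P * ℓ) (+-∸-assoc (P * ℓ) 1≤c)) (m+n∸m≡n (P * ℓ) (c ∸ 1)))
            (∸-monoˡ-≤ (P * ℓ) hi))
    low≡d : low a x ≡ d
    low≡d = trans (%-congˡ x≡d+ℓP)
                  (trans ([m+kn]%n≡m%n d ℓ P) (m<n⇒m%n≡m (≤-trans d<c c≤2^a)))
  outof : low a x < c → ∃[ ℓ ] (P * ℓ ≤ x × x ≤ P * ℓ + c ∸ 1)
  outof h = q , subst (_≤ x) (*-comm q P) (m/n*n≤m x P) , x≤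
    where
    q = high a x
    x≤ : x ≤ P * q + c ∸ 1
    x≤ = begin
      x                 ≡⟨ m≡m%n+[m/n]*n x P ⟩
      low a x + q * P   ≤⟨ +-monoˡ-≤ (q * P) (<⇒≤pred h) ⟩
      (c ∸ 1) + q * P   ≡⟨ trans (+-comm (c ∸ 1) _) (cong (_+ (c ∸ 1)) (*-comm q P)) ⟩
      P * q + (c ∸ 1)   ≡⟨ sym (+-∸-assoc (P * q) 1≤c) ⟩
      P * q + c ∸ 1     ∎
      where open ≤-Reasoning

S-below⇔ : ∀ r i x → i < r → S r (x , i) ⇔ (IsVertex r (x , i) × low (suc i) x < J (suc i))
S-below⇔ r i x i<r = mk⇔ into outof
  where
  intervals = interval⇔low (suc i) (J (suc i)) x (J-pos i) (J≤2^suc i)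
  into : S r (x , i) → IsVertex r (x , i) × low (suc i) x < J (suc i)
  into (v , inj₁ (_ , h))   = v , to intervals h
  into (v , inj₂ (refl , _)) = ⊥-elim (<-irrefl refl i<r)
  outof : IsVertex r (x , i) × low (suc i) x < J (suc i) → S r (x , i)
  outof (v , h) = v , inj₁ (i<r , from intervals h)

S-top⇔ : ∀ r x → S r (x , r) ⇔ (IsVertex r (x , r) × x < J (suc r))
S-top⇔ r x = mk⇔ into outof
  where
  into : S r (x , r) → IsVertex r (x , r) × x < J (suc r)
  into (v , inj₁ (r<r , _)) = ⊥-elim (<-irrefl refl r<r)
  into (v , inj₂ (_ , h))   = v , ≤pred⇒< (J-pos r) h
  outof : IsVertex r (x , r) × x < J (suc r) → S r (x , r)
  outof (v , h) = v , inj₂ (refl , <⇒≤pred h)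

T⇔ : ∀ r i x → T r (x , i) ⇔ (IsVertex r (x , i) × low i x < J (suc i))
T⇔ r i x = mk⇔ (λ (v , h) → v , to intervals h) (λ (v , h) → v , from intervals h)
  where
  intervals = interval⇔low i (J (suc i)) x (J-pos i) (J≤2^ i)

Invariant : ℕ → ℕ → Set
Invariant r k =
  (∀ i → (i + k < r ⊎ i ≡ r) → ∀ x → X r k (x , i) ⇔ S r (x , i)) ×
  (∀ i → r ∸ k ≤ i → i < r → ∀ x → X r k (x , i) ⇔ T r (x , i))

invariant-zero : ∀ r → Invariant r 0
invariant-zero r = (λ _ _ _ → ⇔.refl)
                 , (λ i r≤i i<r _ → ⊥-elim (<-irrefl refl (<-≤-trans i<r r≤i)))

-- The step k → k+1, for k+1 ≤ r.  L = r - (k+1) is the level being filled.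
module Step (r k : ℕ) (k<r : suc k ≤ r) (IH : Invariant r k) where

  L = r ∸ suc k

  L+k+1≡r : L + suc k ≡ r
  L+k+1≡r = m∸n+n≡m k<r

  L<r : L < r
  L<r = subst (L <_) L+k+1≡r (m<m+n L (s≤s z≤n))

  L+k<r : L + k < r
  L+k<r = subst (L + k <_) (trans (sym (+-suc L k)) L+k+1≡r) (n<1+n (L + k))

  r∸k≡L+1 : r ∸ k ≡ suc L
  r∸k≡L+1 = trans (cong (_∸ k) (trans (sym L+k+1≡r) (+-suc L k))) (m+n∸n≡m (suc L) k)

  X-level-L : ∀ x → X r k (x , L) ⇔ (IsVertex r (x , L) × low (suc L) x < J (suc L))
  X-level-L x = ⇔.trans (proj₁ IH L (inj₁ L+k<r) x) (S-below⇔ r L x L<r)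

  X-above-L : ∀ i x → suc L ≤ i → i ≤ r → x < 2 ^ r → low i x < J (suc i) → X r k (x , i)
  X-above-L i x L<i i≤r x< h with i ≟ r
  ... | yes refl = from (proj₁ IH r (inj₂ refl) x)
                     (from (S-top⇔ r x) ((x< , ≤-refl) , subst (_< J (suc r)) low≡x h))
    where low≡x = m<n⇒m%n≡m {{2^-nonZero r}} x<
  ... | no i≢r  = from (proj₂ IH i (subst (_≤ i) (sym r∸k≡L+1) L<i) (≤∧≢⇒< i≤r i≢r) x)
                     (from (T⇔ r i x) ((x< , i≤r) , h))

  -- A newly forced vertex on level L satisfies x mod 2^L < J(L+1): its forcing
  -- vertex (y, L+1) is also adjacent to (flip x, L) ≠ (x, L), which must then
  -- lie in X_k, and x, flip x agree in their L lowest bits.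
  forced⇒low : ∀ x → X r (suc k) (x , L) → IsVertex r (x , L) × low L x < J (suc L)
  forced⇒low x (inj₁ old) =
    let (v , h) = to (X-level-L x) old in v , ≤-<-trans (low-mono-suc L x) h
  forced⇒low x (inj₂ (_ , (y , _) , _ , y-level , (inj₁ (_ , _ , L≡level+1 , _) , _) , _)) =
    ⊥-elim (<-irrefl (trans L≡level+1 (cong suc (trans y-level r∸k≡L+1)))
                     (≤-trans (n<1+n L) (n≤1+n _)))
  forced⇒low x (inj₂ (_ , (y , .(suc L)) , _ , _ , (inj₂ (x-vtx , y-vtx , refl , y≈x) , _) , unique)) =
    x-vtx , ≤-<-trans (subst (_≤ low (suc L) z) (flip-low L x) (low-mono-suc L z)) z-low
    where
    z = flipE (suc L) x
    z-vtx : IsVertex r (z , L)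
    z-vtx = flip-< L x r L<r (proj₁ x-vtx) , proj₂ x-vtx
    y≈z : (y ≡ x) ⊎ (y ≡ z) → (y ≡ z) ⊎ (y ≡ flipE (suc L) z)
    y≈z (inj₁ e) = inj₂ (trans e (sym (flip-involutive L x)))
    y≈z (inj₂ e) = inj₁ e
    z-adj : Adj r (y , suc L) (z , L)
    z-adj = inj₂ (z-vtx , y-vtx , refl , y≈z y≈x)
    z-low : low (suc L) z < J (suc L)
    z-low with low (suc L) z <? J (suc L)
    ... | yes h = h
    ... | no ¬h = ⊥-elim (flip-moves L x (cong proj₁
                    (unique (z , L) z-adj (λ z∈X → ¬h (proj₂ (to (X-level-L z) z∈X))))))

  -- Conversely such a vertex is in X_(k+1): either already in X_k, or bit L of
  -- x is 1 and (flip x, L+1) ∈ X_k forces it.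
  low⇒forced : ∀ x → IsVertex r (x , L) × low L x < J (suc L) → X r (suc k) (x , L)
  low⇒forced x (x-vtx , h) with low (suc L) x <? J (suc L)
  ... | yes h' = inj₁ (from (X-level-L x) (x-vtx , h'))
  ... | no ¬h' = inj₂ (refl , (y , suc L) , y∈X , sym r∸k≡L+1 , (x-adj , x∉X) , unique)
    where
    x∉X : ¬ X r k (x , L)
    x∉X x∈X = ¬h' (proj₂ (to (X-level-L x) x∈X))
    bit≡1 : bit L x ≡ 1
    bit≡1 with bit L x ≟ 1
    ... | yes e = e
    ... | no ne = ⊥-elim (¬h' (subst (_< J (suc L)) (sym low-suc≡low) h))
      where
      low-suc≡low : low (suc L) x ≡ low L x
      low-suc≡low = trans (low-suc L x)
        (trans (cong (λ t → low L x + t * 2 ^ L) (bit≢1⇒bit≡0 L x ne)) (+-identityʳ _))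
    y = flipE (suc L) x
    y-low : low (suc L) y ≡ low L x
    y-low = trans (low-suc L y)
      (trans (cong₂ (λ s t → s + t * 2 ^ L) (flip-low L x) (trans (flip-bit L x) (cong (1 ∸_) bit≡1)))
             (+-identityʳ _))
    y-small : low (suc L) y < J (suc L)
    y-small = subst (_< J (suc L)) (sym y-low) h
    y-vtx : IsVertex r (y , suc L)
    y-vtx = flip-< L x r L<r (proj₁ x-vtx) , L<r
    y∈X : X r k (y , suc L)
    y∈X = X-above-L (suc L) y ≤-refl L<r (proj₁ y-vtx) (<-≤-trans y-small (m≤m+n (J (suc L)) _))
    x-adj : Adj r (y , suc L) (x , L)
    x-adj = inj₂ (x-vtx , y-vtx , refl , inj₂ refl)
    -- Up-neighbours (u, L+2) of (y, L+1) have u mod 2^(L+2) < J(L+1) + 2^(L+1) = J(L+3).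
    up-small : ∀ u → (u ≡ y) ⊎ (u ≡ flipE (suc (suc L)) y) → low (suc (suc L)) u < J (suc (suc (suc L)))
    up-small u u≈y = begin-strict
        low (suc (suc L)) u     ≤⟨ up-neighbour-low L y u u≈y ⟩
        low (suc L) y + 2 ^ suc L ≡⟨ cong (_+ 2 ^ suc L) y-low ⟩
        low L x + 2 ^ suc L     <⟨ +-monoˡ-< (2 ^ suc L) h ⟩
        J (suc L) + 2 ^ suc L   ≡⟨ sym (J-two-steps L) ⟩
        J (suc (suc (suc L)))   ∎
      where open ≤-Reasoning
    unique : ∀ u → Adj r (y , suc L) u → ¬ X r k u → u ≡ (x , L)
    unique (u , .(suc (suc L))) (inj₁ (_ , u-vtx , refl , u≈y)) u∉X =
      ⊥-elim (u∉X (X-above-L (suc (suc L)) u (n≤1+n _) (proj₂ u-vtx) (proj₁ u-vtx) (up-small u u≈y)))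
    unique (u , c) (inj₂ (u-vtx , _ , L+1≡c+1 , y≈u)) u∉X with suc-injective L+1≡c+1
    ... | refl with y≈u
    ... | inj₁ y≡u = ⊥-elim (u∉X (from (X-level-L u) (u-vtx , subst (λ t → low (suc L) t < J (suc L)) y≡u y-small)))
    ... | inj₂ y≡flip-u = cong (_, L)
          (trans (sym (flip-involutive L u)) (trans (cong (flipE (suc L)) (sym y≡flip-u)) (flip-involutive L x)))

  X-level-L-next : ∀ x → X r (suc k) (x , L) ⇔ T r (x , L)
  X-level-L-next x = ⇔.trans (mk⇔ (forced⇒low x) (low⇒forced x)) (⇔.sym (T⇔ r L x))

  X-off-L : ∀ i x → ¬ i ≡ L → X r (suc k) (x , i) ⇔ X r k (x , i)
  X-off-L i x i≢L = mk⇔ unchanged inj₁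
    where
    unchanged : X r (suc k) (x , i) → X r k (x , i)
    unchanged (inj₁ p)       = p
    unchanged (inj₂ (e , _)) = ⊥-elim (i≢L e)

  invariant-suc : Invariant r (suc k)
  invariant-suc = lower , upper
    where
    lower : ∀ i → (i + suc k < r ⊎ i ≡ r) → ∀ x → X r (suc k) (x , i) ⇔ S r (x , i)
    lower i range x = ⇔.trans (X-off-L i x i≢L) (proj₁ IH i (weaken range) x)
      where
      i≢L : ¬ i ≡ L
      i≢L refl = L-out-of-range range
        where
        L-out-of-range : ¬ (L + suc k < r ⊎ L ≡ r)
        L-out-of-range (inj₁ lt) = <-irrefl L+k+1≡r lt
        L-out-of-range (inj₂ eq) = <-irrefl eq L<r
      weaken : (i + suc k < r ⊎ i ≡ r) → i + k < r ⊎ i ≡ r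
      weaken (inj₁ lt) = inj₁ (<-trans (subst (i + k <_) (sym (+-suc i k)) (n<1+n _)) lt)
      weaken (inj₂ eq) = inj₂ eq
    upper : ∀ i → r ∸ suc k ≤ i → i < r → ∀ x → X r (suc k) (x , i) ⇔ T r (x , i)
    upper i L≤i i<r x with i ≟ L
    ... | yes refl = X-level-L-next x
    ... | no i≢L  = ⇔.trans (X-off-L i x i≢L)
                      (proj₂ IH i (subst (_≤ i) (sym r∸k≡L+1) (≤∧≢⇒< L≤i (λ e → i≢L (sym e)))) i<r x)

invariant : ∀ r k → k ≤ r → Invariant r k
invariant r zero    _   = invariant-zero r
invariant r (suc k) k<r = Step.invariant-suc r k k<r (invariant r k (≤-trans (n≤1+n k) k<r))

lemma3p2 : (r : ℕ) → 1 ≤ r → (k : ℕ) → k ≤ r →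
    (∀ i → (i + k < r ⊎ i ≡ r) → ∀ x → X r k (x , i) ⇔ S r (x , i)) ×
    (∀ i → r ∸ k ≤ i → i < r → ∀ x → X r k (x , i) ⇔ T r (x , i))
lemma3p2 r _ k k≤r = invariant r k k≤r
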